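{- For every term variable $x$ and every term type $\delta$, $x\in[\![\delta]\!]$.
   Context: Pure $\lambda\mu$-calculus: terms $M,N ::= x \mid \lambda x.M \mid MN \mid \mu\alpha.C$, commands $C ::= [\alpha]M$; reduction is the compatible closure of $(\lambda x.M)N\to M[N/x]$ and $(\mu\beta.C)N\to\mu\beta.(C[\beta\Leftarrow N])$, where $C[\beta\Leftarrow N]$ replaces every subcommand $[\beta]P$ by $[\beta](P[\beta\Leftarrow N])N$. $\mathcal{SN}$ is the set of strongly normalising terms. A stack is a finite (possibly empty) sequence $\vec L=L_1{:}\cdots{:}L_k$ of terms, $M\vec L=ML_1\cdots L_k$; $\mathcal{SN}^*$ is the set of finite stacks of terms in $\mathcal{SN}$. Types: with a single constant $\nu$ and a symbol $\omega$ (not itself a type), term types $\delta ::= \nu \mid \omega\to\nu \mid \kappa\to\nu \mid \delta\wedge\delta$ and stack types $\kappa ::= \delta\times\omega \mid \delta\times\kappa \mid \kappa\wedge\kappa$. Interpretation: $[\![\nu]\!]=[\![\omega\to\nu]\!]=\mathcal{SN}$; $[\![\kappa\to\nu]\!]=\{M\mid \forall\vec L\in[\![\kappa]\!],\ M\vec L\in\mathcal{SN}\}$; $[\![\delta\times\omega]\!]=\{N{:}\vec L\mid N\in[\![\delta]\!],\vec L\in\mathcal{SN}^*\}$; $[\![\delta\times\kappa]\!]=\{N{:}\vec L\mid N\in[\![\delta]\!],\vec L\in[\![\kappa]\!]\}$; $[\![\sigma\wedge\tau]\!]=[\![\sigma]\!]\cap[\![\tau]\!]$. -}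

module Defs where

open import Data.Nat using (ℕ; zero; suc; _≟_)
open import Data.List using (List; []; _∷_; foldl)
open import Data.List.Relation.Unary.All using (All)
open import Data.Product using (_×_)
open import Data.Empty using (⊥)
open import Relation.Nullary using (yes; no)
open import Induction.WellFounded using (Acc)
open import Function using (flip)

-- Pure λμ-terms, locally nameless-free de Bruijn representation with two
-- independent index spaces: term variables (bound by lam) and
-- names / μ-variables (bound by mu).
mutual
  data Term : Set where
    var : ℕ → Term
    lam : Term → Term
    app : Term → Term → Term
    mu  : Cmd → Term

  data Cmd : Set where
    named : ℕ → Term → Cmd

ext : (ℕ → ℕ) → ℕ → ℕ
ext ρ zero    = zero
ext ρ (suc n) = suc (ρ n)

mutual
  renT : (ℕ → ℕ) → Term → Term
  renT ρ (var x)   = var (ρ x)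
  renT ρ (lam M)   = lam (renT (ext ρ) M)
  renT ρ (app M N) = app (renT ρ M) (renT ρ N)
  renT ρ (mu C)    = mu (renTC ρ C)

  renTC : (ℕ → ℕ) → Cmd → Cmd
  renTC ρ (named α M) = named α (renT ρ M)

mutual
  renN : (ℕ → ℕ) → Term → Term
  renN ρ (var x)   = var x
  renN ρ (lam M)   = lam (renN ρ M)
  renN ρ (app M N) = app (renN ρ M) (renN ρ N)
  renN ρ (mu C)    = mu (renNC (ext ρ) C)

  renNC : (ℕ → ℕ) → Cmd → Cmd
  renNC ρ (named α M) = named (ρ α) (renN ρ M)

exts : (ℕ → Term) → ℕ → Term
exts σ zero    = var zero
exts σ (suc n) = renT suc (σ n)

mutual
  sub : (ℕ → Term) → Term → Term
  sub σ (var x)   = σ x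
  sub σ (lam M)   = lam (sub (exts σ) M)
  sub σ (app M N) = app (sub σ M) (sub σ N)
  sub σ (mu C)    = mu (subC (λ n → renN suc (σ n)) C)

  subC : (ℕ → Term) → Cmd → Cmd
  subC σ (named α M) = named α (sub σ M)

single : Term → ℕ → Term
single N zero    = N
single N (suc n) = var n

_[_/0] : Term → Term → Term
M [ N /0] = sub (single N) M

mutual
  ssub : ℕ → Term → Term → Term
  ssub β N (var x)   = var x
  ssub β N (lam M)   = lam (ssub β (renT suc N) M)
  ssub β N (app M P) = app (ssub β N M) (ssub β N P)
  ssub β N (mu C)    = mu (ssubC (suc β) (renN suc N) C)

  ssubC : ℕ → Term → Cmd → Cmd
  ssubC β N (named α P) with α ≟ β
  ... | yes _ = named α (app (ssub β N P) N)
  ... | no _  = named α (ssub β N P)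

mutual
  infix 4 _⟶_ _⟶c_
  data _⟶_ : Term → Term → Set where
    β-red  : ∀ {M N} → app (lam M) N ⟶ M [ N /0]
    μ-red  : ∀ {C N} → app (mu C) N ⟶ mu (ssubC zero (renN suc N) C)
    ξ-lam  : ∀ {M M'} → M ⟶ M' → lam M ⟶ lam M'
    ξ-appL : ∀ {M M' N} → M ⟶ M' → app M N ⟶ app M' N
    ξ-appR : ∀ {M N N'} → N ⟶ N' → app M N ⟶ app M N'
    ξ-mu   : ∀ {C C'} → C ⟶c C' → mu C ⟶ mu C'

  data _⟶c_ : Cmd → Cmd → Set where
    ξ-named : ∀ {α M M'} → M ⟶ M' → named α M ⟶c named α M'

SN : Term → Set
SN = Acc (flip _⟶_)

Stack : Set
Stack = List Term

_·*_ : Term → Stack → Term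
M ·* L = foldl app M L

SN* : Stack → Set
SN* = All SN

mutual
  data TType : Set where
    ν     : TType
    ω⇒ν   : TType
    _⇒ν   : SType → TType
    _∧_   : TType → TType → TType

  data SType : Set where
    _×ω   : TType → SType
    _×s_  : TType → SType → SType
    _∧s_  : SType → SType → SType

mutual
  ⟦_⟧ : TType → Term → Set
  ⟦ ν ⟧ M       = SN M
  ⟦ ω⇒ν ⟧ M     = SN M
  ⟦ κ ⇒ν ⟧ M    = ∀ (L : Stack) → ⟦ κ ⟧s L → SN (M ·* L)
  ⟦ δ ∧ δ' ⟧ M  = ⟦ δ ⟧ M × ⟦ δ' ⟧ M

  ⟦_⟧s : SType → Stack → Set
  ⟦ δ ×ω ⟧s []         = ⊥
  ⟦ δ ×ω ⟧s (N ∷ L)    = ⟦ δ ⟧ N × SN* L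
  ⟦ δ ×s κ ⟧s []       = ⊥
  ⟦ δ ×s κ ⟧s (N ∷ L)  = ⟦ δ ⟧ N × ⟦ κ ⟧s L
  ⟦ κ ∧s κ' ⟧s L       = ⟦ κ ⟧s L × ⟦ κ' ⟧s L

-- A variable applied to strongly normalising arguments is strongly normalising,
-- since it never creates a redex. This settles the base types and, for a stack
-- type κ, reduces x ∈ ⟦ κ ⇒ν ⟧ to ⟦ κ ⟧s ⊆ SN*. The latter is proved simultaneously
-- with the statement itself: ⟦ κ ⇒ν ⟧ ⊆ SN because ⟦ κ ⟧s contains a long enough
-- stack of variables, which lie in every ⟦ δ ⟧ by induction.
module Submission where

open import Defs
open import Data.Nat using (ℕ; zero; suc; _≤_; _⊔_; s≤s)
open import Data.Nat.Properties using (m⊔n≤o⇒m≤o; m⊔n≤o⇒n≤o; ≤-refl)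
open import Data.List using ([]; _∷_; replicate)
open import Data.List.Relation.Unary.All using ([]; _∷_)
open import Data.Product using (_,_)
open import Data.Empty using (⊥-elim)
open import Relation.Nullary using (¬_)
open import Induction.WellFounded using (acc)

data VarHeaded : Term → Set where
  var : ∀ x → VarHeaded (var x)
  app : ∀ {M N} → VarHeaded M → VarHeaded (app M N)

VarHeaded-⟶ : ∀ {M M'} → VarHeaded M → M ⟶ M' → VarHeaded M'
VarHeaded-⟶ (var x)       ()
VarHeaded-⟶ (app (var x)) (ξ-appL ())
VarHeaded-⟶ (app (app h)) (ξ-appL r) = app (VarHeaded-⟶ (app h) r)
VarHeaded-⟶ (app h)       (ξ-appR r) = app h

lam-not-VarHeaded : ∀ {M} → ¬ VarHeaded (lam M)
lam-not-VarHeaded ()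

mu-not-VarHeaded : ∀ {C} → ¬ VarHeaded (mu C)
mu-not-VarHeaded ()

var-SN : ∀ x → SN (var x)
var-SN x = acc λ ()

app-SN : ∀ {M N} → VarHeaded M → SN M → SN N → SN (app M N)
app-SN h (acc sn-M) (acc sn-N) = acc λ where
  β-red      → ⊥-elim (lam-not-VarHeaded h)
  μ-red      → ⊥-elim (mu-not-VarHeaded h)
  (ξ-appL r) → app-SN (VarHeaded-⟶ h r) (sn-M r) (acc sn-N)
  (ξ-appR r) → app-SN h (acc sn-M) (sn-N r)

·*-SN : ∀ {M} L → VarHeaded M → SN M → SN* L → SN (M ·* L)
·*-SN []      h sn-M _             = sn-M
·*-SN (N ∷ L) h sn-M (sn-N ∷ sn-L) = ·*-SN L (app h) (app-SN h sn-M sn-N) sn-L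

app-SN⁻ˡ : ∀ {M N} → SN (app M N) → SN M
app-SN⁻ˡ (acc sn) = acc λ r → app-SN⁻ˡ (sn (ξ-appL r))

·*-SN⁻ : ∀ {M} L → SN (M ·* L) → SN M
·*-SN⁻ []      sn = sn
·*-SN⁻ (N ∷ L) sn = app-SN⁻ˡ (·*-SN⁻ L sn)

-- Every stack in ⟦ κ ⟧s has length at least depth κ.
depth : SType → ℕ
depth (δ ×ω)    = 1
depth (δ ×s κ)  = suc (depth κ)
depth (κ ∧s κ') = depth κ ⊔ depth κ'

vars : ℕ → Stack
vars n = replicate n (var 0)

vars-SN* : ∀ n → SN* (vars n)
vars-SN* zero    = []
vars-SN* (suc n) = var-SN 0 ∷ vars-SN* n

mutual
  var∈⟦_⟧ : (δ : TType) (x : ℕ) → ⟦ δ ⟧ (var x)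
  var∈⟦ ν ⟧      x     = var-SN x
  var∈⟦ ω⇒ν ⟧    x     = var-SN x
  var∈⟦ κ ⇒ν ⟧   x L l = ·*-SN L (var x) (var-SN x) (⟦ κ ⟧s⊆SN* L l)
  var∈⟦ δ ∧ δ' ⟧ x     = var∈⟦ δ ⟧ x , var∈⟦ δ' ⟧ x

  vars∈⟦_⟧s : (κ : SType) (n : ℕ) → depth κ ≤ n → ⟦ κ ⟧s (vars n)
  vars∈⟦ δ ×ω ⟧s    (suc n) _       = var∈⟦ δ ⟧ 0 , vars-SN* n
  vars∈⟦ δ ×s κ ⟧s  (suc n) (s≤s d) = var∈⟦ δ ⟧ 0 , vars∈⟦ κ ⟧s n d
  vars∈⟦ κ ∧s κ' ⟧s n       d       =
    vars∈⟦ κ ⟧s n (m⊔n≤o⇒m≤o (depth κ) (depth κ') d) ,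
    vars∈⟦ κ' ⟧s n (m⊔n≤o⇒n≤o (depth κ) (depth κ') d)

  ⟦_⟧⊆SN : (δ : TType) (M : Term) → ⟦ δ ⟧ M → SN M
  ⟦ ν ⟧⊆SN      M m       = m
  ⟦ ω⇒ν ⟧⊆SN    M m       = m
  ⟦ κ ⇒ν ⟧⊆SN   M m       = ·*-SN⁻ (vars (depth κ)) (m _ (vars∈⟦ κ ⟧s (depth κ) ≤-refl))
  ⟦ δ ∧ δ' ⟧⊆SN M (m , _) = ⟦ δ ⟧⊆SN M m

  ⟦_⟧s⊆SN* : (κ : SType) (L : Stack) → ⟦ κ ⟧s L → SN* L
  ⟦ δ ×ω ⟧s⊆SN*    (N ∷ L) (n , sn-L) = ⟦ δ ⟧⊆SN N n ∷ sn-L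
  ⟦ δ ×s κ ⟧s⊆SN*  (N ∷ L) (n , l)    = ⟦ δ ⟧⊆SN N n ∷ ⟦ κ ⟧s⊆SN* L l
  ⟦ κ ∧s κ' ⟧s⊆SN* L       (l , _)    = ⟦ κ ⟧s⊆SN* L l

corollary2p13 : (x : ℕ) (δ : TType) → ⟦ δ ⟧ (var x)
corollary2p13 x δ = var∈⟦ δ ⟧ x
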